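{- Every normal variety $\mathcal V$ of residuated lattices satisfies the quasi-equation $x\vee y\approx1\ \Longrightarrow\ l_w(x)\vee r_z(y)\approx1$.
   Context: Residuated lattices: algebras $\langle A,\vee,\wedge,\cdot,/,\backslash,1\rangle$ with lattice reduct, monoid reduct and $xy\le z\iff y\le x\backslash z\iff x\le z/y$. Conjugates: $l_w(x)=w\backslash(xw)\wedge1$, $r_z(x)=(zx)/z\wedge1$. A filter of $\mathbf A$ is a lattice filter containing $1$ and closed under multiplication; a congruence filter is one of the form $\bigcup\{a/\theta:a\ge1\}$ for a congruence $\theta$, equivalently a filter $F$ with $l_b(a),r_b(a)\in F$ for all $a\in F$, $b\in A$. $\mathbf A$ is normal if every filter is a congruence filter; a variety is normal if all its members are. -}

module Defs where

open import Level using (Level; _⊔_; suc; Setω)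
open import Data.Nat using (ℕ)
open import Data.Product using (Σ; ∃; _×_)
open import Function.Bundles using (_⇔_)
open import Relation.Binary.Core using (Rel)
open import Relation.Binary.Structures using (IsEquivalence)
open import Algebra.Core using (Op₂)
open import Algebra.Definitions using (Congruent₂)
open import Algebra.Structures using (IsMonoid)
open import Algebra.Lattice.Structures using (IsLattice)

-- Residuated lattices over a setoid carrier.
-- x ≤ y is the lattice order  x ∧ y ≈ x ;  x ⧵ y is the left residual x\y,
-- x ⧸ y the right residual x/y, 𝟏 the monoid unit.
record ResLattice (c ℓ : Level) : Set (suc (c ⊔ ℓ)) where
  infix  4 _≈_
  infixr 6 _∨_
  infixr 7 _∧_
  infixl 8 _·_ _⧵_ _⧸_
  field
    Carrier   : Set c
    _≈_       : Rel Carrier ℓ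
    _∨_ _∧_   : Op₂ Carrier
    _·_       : Op₂ Carrier
    _⧵_ _⧸_   : Op₂ Carrier
    𝟏         : Carrier
    isLattice : IsLattice _≈_ _∨_ _∧_
    isMonoid  : IsMonoid _≈_ _·_ 𝟏
    ⧵-cong    : Congruent₂ _≈_ _⧵_
    ⧸-cong    : Congruent₂ _≈_ _⧸_
    resid-⧵   : ∀ x y z → ((x · y) ∧ z ≈ x · y) ⇔ (y ∧ (x ⧵ z) ≈ y)
    resid-⧸   : ∀ x y z → ((x · y) ∧ z ≈ x · y) ⇔ (x ∧ (z ⧸ y) ≈ x)

  infix 4 _≤_
  _≤_ : Carrier → Carrier → Set ℓ
  x ≤ y = x ∧ y ≈ x

  l : Carrier → Carrier → Carrier
  l w x = (w ⧵ (x · w)) ∧ 𝟏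

  r : Carrier → Carrier → Carrier
  r z x = ((z · x) ⧸ z) ∧ 𝟏

module _ {c ℓ : Level} (A : ResLattice c ℓ) where
  open ResLattice A

  record Filter (ℓ' : Level) : Set (c ⊔ ℓ ⊔ suc ℓ') where
    field
      F      : Carrier → Set ℓ'
      upward : ∀ {x y} → x ≤ y → F x → F y
      ∧-clos : ∀ {x y} → F x → F y → F (x ∧ y)
      𝟏∈F    : F 𝟏
      ·-clos : ∀ {x y} → F x → F y → F (x · y)

  record IsCongruence {ℓθ : Level} (θ : Rel Carrier ℓθ) : Set (c ⊔ ℓ ⊔ ℓθ) where
    field
      isEquivalence : IsEquivalence θ
      ≈⊆θ     : ∀ {x y} → x ≈ y → θ x y
      ∨-cong  : ∀ {x y u v} → θ x y → θ u v → θ (x ∨ u) (y ∨ v)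
      ∧-cong  : ∀ {x y u v} → θ x y → θ u v → θ (x ∧ u) (y ∧ v)
      ·-cong  : ∀ {x y u v} → θ x y → θ u v → θ (x · u) (y · v)
      ⧵-congθ : ∀ {x y u v} → θ x y → θ u v → θ (x ⧵ u) (y ⧵ v)
      ⧸-congθ : ∀ {x y u v} → θ x y → θ u v → θ (x ⧸ u) (y ⧸ v)

  IsCongruenceFilter : ∀ {ℓ'} → Filter ℓ' → Set (suc (c ⊔ ℓ ⊔ ℓ'))
  IsCongruenceFilter {ℓ'} Φ =
    Σ (Rel Carrier (c ⊔ ℓ ⊔ ℓ')) λ θ →
      IsCongruence θ × (∀ x → Filter.F Φ x ⇔ ∃ λ a → (𝟏 ≤ a) × θ a x)

  Normal : Setω
  Normal = ∀ {ℓ'} (Φ : Filter ℓ') → IsCongruenceFilter Φ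

infixr 6 _∨ₜ_
infixr 7 _∧ₜ_
infixl 8 _·ₜ_ _⧵ₜ_ _⧸ₜ_
data Term : Set where
  var  : ℕ → Term
  _∨ₜ_ _∧ₜ_ _·ₜ_ _⧵ₜ_ _⧸ₜ_ : Term → Term → Term
  𝟏ₜ   : Term

module _ {c ℓ : Level} (A : ResLattice c ℓ) where
  open ResLattice A
  ⟦_⟧ : Term → (ℕ → Carrier) → Carrier
  ⟦ var i ⟧ ρ = ρ i
  ⟦ s ∨ₜ t ⟧ ρ = ⟦ s ⟧ ρ ∨ ⟦ t ⟧ ρ
  ⟦ s ∧ₜ t ⟧ ρ = ⟦ s ⟧ ρ ∧ ⟦ t ⟧ ρ
  ⟦ s ·ₜ t ⟧ ρ = ⟦ s ⟧ ρ · ⟦ t ⟧ ρ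
  ⟦ s ⧵ₜ t ⟧ ρ = ⟦ s ⟧ ρ ⧵ ⟦ t ⟧ ρ
  ⟦ s ⧸ₜ t ⟧ ρ = ⟦ s ⟧ ρ ⧸ ⟦ t ⟧ ρ
  ⟦ 𝟏ₜ ⟧ ρ = 𝟏

  _⊨_ : ∀ {e} → (Term → Term → Set e) → Set (c ⊔ ℓ ⊔ e)
  _⊨_ E = ∀ s t → E s t → ∀ (ρ : ℕ → Carrier) → ⟦ s ⟧ ρ ≈ ⟦ t ⟧ ρ

-- A variety of residuated lattices is the class Mod(E) of residuated lattices
-- satisfying a set E of equations; it is normal if all its members are normal.
NormalVariety : ∀ {e} → (Term → Term → Set e) → Setω
NormalVariety E = ∀ {c ℓ} (A : ResLattice c ℓ) → _⊨_ A E → Normal A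

{-# OPTIONS --safe #-}
-- For c ≤ 1 the elements a with 1 ≤ (a ∧ 1) ∨ c form a filter, because
-- (p ∨ c)(q ∨ c) ≤ pq ∨ c whenever p, q, c ≤ 1. In a normal algebra this
-- filter is a congruence filter and hence closed under conjugates. If x ∨ y = 1,
-- then y lies in the filter for c = x, so r_z(y) does; read back, this puts x in
-- the filter for c = r_z(y), hence l_w(x) as well, which says 1 ≤ l_w(x) ∨ r_z(y).
module Submission where

open import Defs
open import Level using (Level)
open import Data.Product using (_,_)
open import Function.Bundles using (Equivalence)
open import Relation.Binary.Core using (Rel)
open import Relation.Binary.Structures using (IsEquivalence)
open import Algebra.Structures using (IsMonoid)
open import Algebra.Lattice.Bundles using () renaming (Lattice to AlgLattice)
open import Relation.Binary.Lattice.Bundles using () renaming (Lattice to OrderLattice)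
import Algebra.Lattice.Properties.Lattice as AlgLatticeProperties
import Relation.Binary.Lattice.Properties.JoinSemilattice as JoinSemilatticeProperties
import Relation.Binary.Lattice.Properties.MeetSemilattice as MeetSemilatticeProperties
import Relation.Binary.Reasoning.PartialOrder as ≤-Reasoning

module ResLatticeProperties {c ℓ : Level} (A : ResLattice c ℓ) where
  open ResLattice A
  open IsMonoid isMonoid using (identityˡ; identityʳ)

  algLattice : AlgLattice c ℓ
  algLattice = record { isLattice = isLattice }

  open AlgLattice algLattice using (sym)

  -- The standard library orders a lattice by x ≈ x ∧ y, the symmetric form of _≤_.
  orderLattice : OrderLattice c ℓ ℓ
  orderLattice = record
    { _≤_       = _≤_
    ; isLattice = record
      { isPartialOrder = record
        { isPreorder = record
          { isEquivalence = AlgLattice.isEquivalence algLattice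
          ; reflexive     = λ x≈y → sym (O.reflexive x≈y)
          ; trans         = λ x≤y y≤z → sym (O.trans (sym x≤y) (sym y≤z))
          }
        ; antisym = λ x≤y y≤x → O.antisym (sym x≤y) (sym y≤x)
        }
      ; supremum = λ x y → sym (O.x≤x∨y x y) , sym (O.y≤x∨y x y)
                         , λ z x≤z y≤z → sym (O.∨-least (sym x≤z) (sym y≤z))
      ; infimum  = λ x y → sym (O.x∧y≤x x y) , sym (O.x∧y≤y x y)
                         , λ z z≤x z≤y → sym (O.∧-greatest (sym z≤x) (sym z≤y))
      }
    }
    where
    module O = OrderLattice (AlgLatticeProperties.∨-∧-orderTheoreticLattice algLattice)

  open OrderLattice orderLattice
    using (refl; reflexive; trans; antisym; poset
          ; x≤x∨y; y≤x∨y; ∨-least; x∧y≤x; x∧y≤y; ∧-greatest)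
  open JoinSemilatticeProperties (OrderLattice.joinSemilattice orderLattice)
    using (∨-monotonic; ∨-comm)
  open MeetSemilatticeProperties (OrderLattice.meetSemilattice orderLattice)
    using (∧-monotonic)

  ·-monoˡ-≤ : ∀ z {x y} → x ≤ y → x · z ≤ y · z
  ·-monoˡ-≤ z {x} {y} x≤y = Equivalence.from (resid-⧸ x z (y · z))
    (trans x≤y (Equivalence.to (resid-⧸ y z (y · z)) refl))

  ·-monoʳ-≤ : ∀ z {x y} → x ≤ y → z · x ≤ z · y
  ·-monoʳ-≤ z {x} {y} x≤y = Equivalence.from (resid-⧵ z x (z · y))
    (trans x≤y (Equivalence.to (resid-⧵ z y (z · y)) refl))

  ·-mono-≤ : ∀ {x y u v} → x ≤ y → u ≤ v → x · u ≤ y · v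
  ·-mono-≤ {y = y} {u} x≤y u≤v = trans (·-monoˡ-≤ u x≤y) (·-monoʳ-≤ y u≤v)

  ·-distribʳ-∨ : ∀ z x y → (x ∨ y) · z ≤ x · z ∨ y · z
  ·-distribʳ-∨ z x y = Equivalence.from (resid-⧸ (x ∨ y) z _)
    (∨-least (Equivalence.to (resid-⧸ x z _) (x≤x∨y _ _))
             (Equivalence.to (resid-⧸ y z _) (y≤x∨y _ _)))

  ·-distribˡ-∨ : ∀ z x y → z · (x ∨ y) ≤ z · x ∨ z · y
  ·-distribˡ-∨ z x y = Equivalence.from (resid-⧵ z (x ∨ y) _)
    (∨-least (Equivalence.to (resid-⧵ z x _) (x≤x∨y _ _))
             (Equivalence.to (resid-⧵ z y _) (y≤x∨y _ _)))

  x≤1⇒x·y≤y : ∀ {x y} → x ≤ 𝟏 → x · y ≤ y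
  x≤1⇒x·y≤y {y = y} x≤1 = trans (·-monoˡ-≤ y x≤1) (reflexive (identityˡ y))

  y≤1⇒x·y≤x : ∀ {x y} → y ≤ 𝟏 → x · y ≤ x
  y≤1⇒x·y≤x {x} y≤1 = trans (·-monoʳ-≤ x y≤1) (reflexive (identityʳ x))

  [x∨z]·[y∨z]≤x·y∨z : ∀ {x y z} → x ≤ 𝟏 → y ≤ 𝟏 → z ≤ 𝟏 → (x ∨ z) · (y ∨ z) ≤ x · y ∨ z
  [x∨z]·[y∨z]≤x·y∨z {x} {y} {z} x≤1 y≤1 z≤1 = begin
    (x ∨ z) · (y ∨ z)              ≤⟨ ·-distribʳ-∨ (y ∨ z) x z ⟩
    x · (y ∨ z) ∨ z · (y ∨ z)      ≤⟨ ∨-monotonic (·-distribˡ-∨ x y z) (y≤1⇒x·y≤x (∨-least y≤1 z≤1)) ⟩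
    (x · y ∨ x · z) ∨ z            ≤⟨ ∨-monotonic (∨-monotonic refl (x≤1⇒x·y≤y x≤1)) refl ⟩
    (x · y ∨ z) ∨ z                ≤⟨ ∨-least refl (y≤x∨y _ _) ⟩
    x · y ∨ z                      ∎
    where open ≤-Reasoning poset

  1≤l : ∀ w {b} → 𝟏 ≤ b → 𝟏 ≤ l w b
  1≤l w {b} 1≤b = ∧-greatest (Equivalence.to (resid-⧵ w 𝟏 (b · w)) w·1≤b·w) refl
    where
    open ≤-Reasoning poset
    w·1≤b·w : w · 𝟏 ≤ b · w
    w·1≤b·w = begin
      w · 𝟏  ≈⟨ identityʳ w ⟩
      w      ≈⟨ sym (identityˡ w) ⟩
      𝟏 · w  ≤⟨ ·-monoˡ-≤ w 1≤b ⟩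
      b · w  ∎

  1≤r : ∀ z {b} → 𝟏 ≤ b → 𝟏 ≤ r z b
  1≤r z {b} 1≤b = ∧-greatest (Equivalence.to (resid-⧸ 𝟏 z (z · b)) 1·z≤z·b) refl
    where
    open ≤-Reasoning poset
    1·z≤z·b : 𝟏 · z ≤ z · b
    1·z≤z·b = begin
      𝟏 · z  ≈⟨ identityˡ z ⟩
      z      ≈⟨ sym (identityʳ z) ⟩
      z · 𝟏  ≤⟨ ·-monoʳ-≤ z 1≤b ⟩
      z · b  ∎

  Covers : Carrier → Carrier → Set ℓ
  Covers c a = 𝟏 ≤ a ∧ 𝟏 ∨ c

  Covers⇒1≤a∨c : ∀ {c a} → Covers c a → 𝟏 ≤ a ∨ c
  Covers⇒1≤a∨c covers = trans covers (∨-monotonic (x∧y≤x _ _) refl)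

  1≤a∨c⇒Covers : ∀ {c a} → a ≤ 𝟏 → 𝟏 ≤ a ∨ c → Covers c a
  1≤a∨c⇒Covers a≤1 1≤a∨c = trans 1≤a∨c (∨-monotonic (∧-greatest refl a≤1) refl)

  Covers-sym : ∀ {c a} → c ≤ 𝟏 → Covers c a → Covers a c
  Covers-sym {c} {a} c≤1 covers =
    1≤a∨c⇒Covers c≤1 (trans (Covers⇒1≤a∨c covers) (reflexive (∨-comm a c)))

  Covers-≤ : ∀ {c a b t} → c ≤ 𝟏 → Covers c a → Covers c b →
             (a ∧ 𝟏) · (b ∧ 𝟏) ≤ t → Covers c t
  Covers-≤ {c} {a} {b} {t} c≤1 ca cb a⁻b⁻≤t = begin
    𝟏                                  ≈⟨ sym (identityˡ 𝟏) ⟩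
    𝟏 · 𝟏                              ≤⟨ ·-mono-≤ ca cb ⟩
    (a ∧ 𝟏 ∨ c) · (b ∧ 𝟏 ∨ c)          ≤⟨ [x∨z]·[y∨z]≤x·y∨z (x∧y≤y _ _) (x∧y≤y _ _) c≤1 ⟩
    (a ∧ 𝟏) · (b ∧ 𝟏) ∨ c              ≤⟨ ∨-monotonic (∧-greatest a⁻b⁻≤t a⁻b⁻≤1) refl ⟩
    t ∧ 𝟏 ∨ c                          ∎
    where
    open ≤-Reasoning poset
    a⁻b⁻≤1 : (a ∧ 𝟏) · (b ∧ 𝟏) ≤ 𝟏
    a⁻b⁻≤1 = trans (x≤1⇒x·y≤y (x∧y≤y a 𝟏)) (x∧y≤y b 𝟏)

  coverFilter : ∀ c → c ≤ 𝟏 → Filter A ℓ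
  coverFilter c c≤1 = record
    { F      = Covers c
    ; upward = λ x≤y covers → trans covers (∨-monotonic (∧-monotonic x≤y refl) refl)
    ; ∧-clos = λ ca cb → Covers-≤ c≤1 ca cb (∧-greatest
                 (trans (y≤1⇒x·y≤x (x∧y≤y _ _)) (x∧y≤x _ _))
                 (trans (x≤1⇒x·y≤y (x∧y≤y _ _)) (x∧y≤x _ _)))
    ; 𝟏∈F    = trans (∧-greatest refl refl) (x≤x∨y _ _)
    ; ·-clos = λ ca cb → Covers-≤ c≤1 ca cb (·-mono-≤ (x∧y≤x _ _) (x∧y≤x _ _))
    }

  module _ {ℓθ} {θ : Rel Carrier ℓθ} (isCongruence : IsCongruence A θ) where
    open IsCongruence isCongruence
    open IsEquivalence isEquivalence using () renaming (refl to θ-refl)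

    l-congθ : ∀ w {a b} → θ a b → θ (l w a) (l w b)
    l-congθ w θab = ∧-cong (⧵-congθ θ-refl (·-cong θab θ-refl)) θ-refl

    r-congθ : ∀ z {a b} → θ a b → θ (r z a) (r z b)
    r-congθ z θab = ∧-cong (⧸-congθ (·-cong θ-refl θab) θ-refl) θ-refl

  module _ {ℓ'} (Φ : Filter A ℓ') (isCongruenceFilter : IsCongruenceFilter A Φ) where
    open Filter Φ

    congruenceFilter-preserves :
      (f : Carrier → Carrier) →
      (∀ {ℓθ} {θ : Rel Carrier ℓθ} → IsCongruence A θ → ∀ {a b} → θ a b → θ (f a) (f b)) →
      (∀ {b} → 𝟏 ≤ b → 𝟏 ≤ f b) →
      ∀ {a} → F a → F (f a)
    congruenceFilter-preserves f f-congθ 1≤f Fa =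
      let (θ , isCongruence , F⇔) = isCongruenceFilter
          (b , 1≤b , θba) = Equivalence.to (F⇔ _) Fa
      in Equivalence.from (F⇔ _) (f b , 1≤f 1≤b , f-congθ isCongruence θba)

    congruenceFilter-l-closed : ∀ w {a} → F a → F (l w a)
    congruenceFilter-l-closed w =
      congruenceFilter-preserves (l w) (λ isCongruence → l-congθ isCongruence w) (1≤l w)

    congruenceFilter-r-closed : ∀ z {a} → F a → F (r z a)
    congruenceFilter-r-closed z =
      congruenceFilter-preserves (r z) (λ isCongruence → r-congθ isCongruence z) (1≤r z)

  normal⇒l∨r≈1 : Normal A → ∀ x y w z → x ∨ y ≈ 𝟏 → l w x ∨ r z y ≈ 𝟏
  normal⇒l∨r≈1 normal x y w z x∨y≈1 = antisym (∨-least (x∧y≤y _ _) (x∧y≤y _ _)) 1≤l∨r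
    where
    r≤1 : r z y ≤ 𝟏
    r≤1 = x∧y≤y _ _

    x≤1 : x ≤ 𝟏
    x≤1 = trans (x≤x∨y x y) (reflexive x∨y≈1)

    y≤1 : y ≤ 𝟏
    y≤1 = trans (y≤x∨y x y) (reflexive x∨y≈1)

    Fx Fr : Filter A ℓ
    Fx = coverFilter x x≤1
    Fr = coverFilter (r z y) r≤1

    y∈Fx : Covers x y
    y∈Fx = 1≤a∨c⇒Covers y≤1 (trans (reflexive (sym x∨y≈1)) (reflexive (∨-comm x y)))

    r∈Fx : Covers x (r z y)
    r∈Fx = congruenceFilter-r-closed Fx (normal Fx) z y∈Fx

    l∈Fr : Covers (r z y) (l w x)
    l∈Fr = congruenceFilter-l-closed Fr (normal Fr) w (Covers-sym x≤1 r∈Fx)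

    1≤l∨r : 𝟏 ≤ l w x ∨ r z y
    1≤l∨r = Covers⇒1≤a∨c l∈Fr

mainTheorem16 : ∀ {e} (E : Term → Term → Set e) → NormalVariety E →
    ∀ {c ℓ : Level} (A : ResLattice c ℓ) → _⊨_ A E →
    let open ResLattice A in
    ∀ x y w z → x ∨ y ≈ 𝟏 → l w x ∨ r z y ≈ 𝟏
mainTheorem16 E normalVariety A A⊨E = normal⇒l∨r≈1 (normalVariety A A⊨E)
  where open ResLatticeProperties A
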